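{- Let $D$ be a digraph. If the cycle graph $C(D)$ contains an induced cycle of length $\ell\ge 4$, then $D$ contains a directed cycle of length at least $\ell$.
   Context: All digraphs are finite, without loops or multiple arcs (pairs of opposite arcs allowed); a directed cycle has length at least $2$. The cycle graph $C(D)$ is the undirected graph whose vertices are the directed cycles of $D$, two being adjacent iff they share at least one vertex. -}

module Defs where

open import Data.Nat using (ℕ; zero; suc; _≤_)
open import Data.Fin using (Fin; toℕ)
open import Data.Bool using (Bool; T)
open import Data.Product using (Σ; ∃; _×_; _,_)
open import Data.Sum using (_⊎_)
open import Data.Empty using (⊥)
open import Relation.Nullary using (¬_)
open import Relation.Binary.PropositionalEquality using (_≡_)

-- A finite digraph on vertex set Fin n.  The arc relation is a Bool-valued
-- function, so there are no multiple arcs; loops are excluded explicitly.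
-- Opposite arcs u→v and v→u are allowed.
record Digraph : Set where
  field
    n        : ℕ
    arc      : Fin n → Fin n → Bool
    loopless : ∀ v → ¬ T (arc v v)

  Arc : Fin n → Fin n → Set
  Arc u v = T (arc u v)

CycSucc : (k : ℕ) → Fin k → Fin k → Set
CycSucc k i j = (suc (toℕ i) ≡ toℕ j) ⊎ (suc (toℕ i) ≡ k × toℕ j ≡ 0)

CycAdj : (k : ℕ) → Fin k → Fin k → Set
CycAdj k i j = CycSucc k i j ⊎ CycSucc k j i

record DiCycle (D : Digraph) : Set where
  open Digraph D
  field
    len   : ℕ
    len≥2 : 2 ≤ len
    vtx   : Fin len → Fin n
    inj   : ∀ i j → vtx i ≡ vtx j → i ≡ j
    arcs  : ∀ i j → CycSucc len i j → Arc (vtx i) (vtx j)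

module _ {D : Digraph} where
  open Digraph D
  open DiCycle

  CArc : DiCycle D → Fin n → Fin n → Set
  CArc C u v = Σ (Fin (len C)) λ i → Σ (Fin (len C)) λ j →
                 CycSucc (len C) i j × vtx C i ≡ u × vtx C j ≡ v

  -- Two directed cycles are the same cycle (same subgraph of D) iff they
  -- have the same arc set (this identifies rotations of the vertex sequence).
  SameCycle : DiCycle D → DiCycle D → Set
  SameCycle C C' = ∀ u v → (CArc C u v → CArc C' u v) × (CArc C' u v → CArc C u v)

  -- Adjacency in the cycle graph C(D): sharing at least one vertex.
  Shares : DiCycle D → DiCycle D → Set
  Shares C C' = Σ (Fin (len C)) λ i → Σ (Fin (len C')) λ j → vtx C i ≡ vtx C' j

record InducedCycleInCycleGraph (D : Digraph) (ℓ : ℕ) : Set where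
  field
    cyc      : Fin ℓ → DiCycle D
    distinct : ∀ i j → ¬ (i ≡ j) → ¬ SameCycle (cyc i) (cyc j)
    induced  : ∀ i j → ¬ (i ≡ j) →
                 (Shares (cyc i) (cyc j) → CycAdj ℓ i j) × (CycAdj ℓ i j → Shares (cyc i) (cyc j))

-- Number the induced cycle of C(D) as W 0, …, W (ℓ-1) and put B = W (ℓ-1), K = ℓ-2.
-- Start at s₀ ∈ W K ∩ B and follow B to its first vertex s₁ in W 0.  From s₁ follow W 0 to
-- its first vertex in W 1, then W 1 to its first vertex in W 2, and so on up to W K.  Since
-- W i and W j are disjoint for 2 ≤ j - i (except the pair W 0, B) and every piece stops at
-- the first vertex of the next cycle, this is a path with at least K arcs.  From its end e
-- follow W K to the first vertex t of the B-piece s₀ → s₁, and close up along the B-piece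
-- from t to s₁.  The three parts are internally disjoint and each has at least one arc
-- (t ∉ W 0, and e ∉ B since a vertex of the chain lying on B lies on W 0), so the cycle has
-- length ≥ 1 + K + 1 = ℓ.

module Submission where

open import Defs
open import Data.Nat using (ℕ; zero; suc; _+_; _≤_; _<_; z≤n; s≤s; NonZero)
open import Data.Nat.Properties
  using (≤-refl; ≤-trans; <-trans; n<1+n; n≤1+n; m≤n⇒m≤1+n; +-comm; +-mono-≤; suc-injective;
         0≢1+n; 1+n≢n; 1+n≰n; <-asym; <-irrefl; module ≤-Reasoning)
open import Data.Nat.DivMod using (_mod_; m<n⇒m%n≡m)
open import Data.Fin using (Fin; toℕ; fromℕ; inject₁) renaming (zero to fzero; suc to fsuc)
open import Data.Fin.Properties using (toℕ-fromℕ<; toℕ-fromℕ; toℕ-inject₁; any?) renaming (_≟_ to _≟ᶠ_; <⇒≢ to <⇒≢ᶠ)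
open import Data.List using (List; []; _∷_; _++_; [_]; length; lookup)
open import Data.List.Properties using (length-++)
open import Data.List.Membership.Propositional using (_∈_)
open import Data.List.Membership.Propositional.Properties using (∈-lookup; ∈-++⁻)
open import Data.List.Relation.Binary.Subset.Propositional using (_⊆_)
open import Data.List.Relation.Binary.Disjoint.Propositional using (Disjoint)
open import Data.List.Relation.Unary.All as All using (All; []; _∷_)
open import Data.List.Relation.Unary.All.Properties using (anti-mono; ¬Any⇒All¬) renaming (++⁺ to All-++⁺)
open import Data.List.Relation.Unary.Any using (here; there) renaming (any? to anyᴸ?)
open import Data.List.Relation.Unary.AllPairs using ([]; _∷_)
open import Data.List.Relation.Unary.Unique.Propositional using (Unique)
open import Data.List.Relation.Unary.Unique.Propositional.Properties using () renaming (++⁺ to Unique-++⁺)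
open import Data.Product using (Σ; ∃; ∃₂; _×_; _,_; proj₁; proj₂)
open import Data.Sum using (_⊎_; inj₁; inj₂)
open import Data.Empty using (⊥-elim)
open import Function using (_∘_)
open import Relation.Nullary using (¬_; Dec; yes; no)
import Relation.Nullary.Decidable as Dec
open import Relation.Unary using (Decidable)
open import Relation.Binary.PropositionalEquality using (_≡_; _≢_; refl; sym; trans; cong; subst)

m<n⇒toℕ-mod≡m : ∀ {m n} .{{_ : NonZero n}} → m < n → toℕ (m mod n) ≡ m
m<n⇒toℕ-mod≡m m<n = trans (toℕ-fromℕ< _) (m<n⇒m%n≡m m<n)

cycSucc⇒≢ : ∀ {k} {a b : Fin k} → 2 ≤ k → CycSucc k a b → a ≢ b
cycSucc⇒≢ _ (inj₁ a+1≡a) refl = 1+n≢n a+1≡a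
cycSucc⇒≢ (s≤s (s≤s _)) (inj₂ (a+1≡k , a≡0)) refl = 0≢1+n (trans (sym a≡0) (suc-injective a+1≡k))

far⇒¬cycAdj : ∀ {k} {a b : Fin k} → 2 + toℕ a ≤ toℕ b → (1 ≤ toℕ a ⊎ suc (toℕ b) < k) → ¬ CycAdj k a b
far⇒¬cycAdj a+2≤b _ (inj₁ (inj₁ a+1≡b)) = 1+n≰n (subst (2 + _ ≤_) (sym a+1≡b) a+2≤b)
far⇒¬cycAdj a+2≤b _ (inj₁ (inj₂ (_ , b≡0))) with subst (2 + _ ≤_) b≡0 a+2≤b
... | ()
far⇒¬cycAdj a+2≤b _ (inj₂ (inj₁ b+1≡a)) = <-asym (≤-trans (n≤1+n _) a+2≤b) (subst (_ <_) b+1≡a ≤-refl)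
far⇒¬cycAdj _ (inj₁ 1≤a) (inj₂ (inj₂ (_ , a≡0))) with subst (1 ≤_) a≡0 1≤a
... | ()
far⇒¬cycAdj _ (inj₂ b+1<k) (inj₂ (inj₂ (b+1≡k , _))) = <-irrefl b+1≡k b+1<k

module _ (D : Digraph) where
  open Digraph D
  open DiCycle

  V : Set
  V = Fin n

  infixr 5 _◅_ _◅◅_

  -- Walk a b xs lists the vertices after a, so it is a path iff Unique (a ∷ xs).
  data Walk : V → V → List V → Set where
    ε   : ∀ {u} → Walk u u []
    _◅_ : ∀ {u v w xs} → Arc u v → Walk v w xs → Walk u w (v ∷ xs)

  _◅◅_ : ∀ {a b c xs ys} → Walk a b xs → Walk b c ys → Walk a c (xs ++ ys)
  ε ◅◅ q = q
  (e ◅ p) ◅◅ q = e ◅ (p ◅◅ q)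

  end∈ : ∀ {a b xs} → Walk a b xs → b ∈ a ∷ xs
  end∈ ε = here refl
  end∈ (_ ◅ p) = there (end∈ p)

  length-pos : ∀ {a b xs} → Walk a b xs → a ≢ b → 1 ≤ length xs
  length-pos ε a≢a = ⊥-elim (a≢a refl)
  length-pos (_ ◅ _) _ = s≤s z≤n

  head∉tail : ∀ {x : V} {xs y} → Unique (x ∷ xs) → y ∈ xs → x ≢ y
  head∉tail (x∉xs ∷ _) y∈xs = All.lookup x∉xs y∈xs

  tail-unique : ∀ {x : V} {xs} → Unique (x ∷ xs) → Unique xs
  tail-unique (_ ∷ xs!) = xs!

  path-suffix : ∀ {a b t xs} → Walk a b xs → Unique (a ∷ xs) → t ∈ a ∷ xs →
                ∃ λ ys → Walk t b ys × Unique (t ∷ ys) × ys ⊆ xs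
  path-suffix w xs! (here refl) = _ , w , xs! , λ y∈ → y∈
  path-suffix (_ ◅ w) (_ ∷ xs!) (there t∈) =
    let ys , w′ , ys! , ys⊆ = path-suffix w xs! t∈ in ys , w′ , ys! , there ∘ ys⊆

  walk⇒path : ∀ {a b xs} → Walk a b xs → ∃ λ ys → Walk a b ys × Unique (a ∷ ys) × ys ⊆ xs
  walk⇒path ε = [] , ε , [] ∷ [] , λ ()
  walk⇒path {a} (_◅_ {v = v} e w) with walk⇒path w
  ... | ys , w′ , ys! , ys⊆ with anyᴸ? (a ≟ᶠ_) (v ∷ ys)
  ...   | yes a∈ = let zs , w″ , zs! , zs⊆ = path-suffix w′ ys! a∈ in zs , w″ , zs! , there ∘ ys⊆ ∘ zs⊆
  ...   | no a∉ = v ∷ ys , e ◅ w′ , ¬Any⇒All¬ _ a∉ ∷ ys! ,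
                 λ { (here refl) → here refl ; (there y∈) → there (ys⊆ y∈) }

  prefix-to-first : ∀ {a b xs} {T : V → Set} → Decidable T → Walk a b xs → T b →
                    ∃₂ λ e ys → Walk a e ys × T e × ys ⊆ xs × (∀ {y} → y ∈ ys → T y → y ≡ e)
  prefix-to-first {a} T? ε Tb = a , [] , ε , Tb , (λ ()) , λ ()
  prefix-to-first T? (_◅_ {v = v} e w) Tb with T? v
  ... | yes Tv = v , [ v ] , e ◅ ε , Tv , (λ { (here refl) → here refl }) , λ { (here refl) _ → refl }
  ... | no ¬Tv =
    let e′ , ys , w′ , Te′ , ys⊆ , first = prefix-to-first T? w Tb
    in e′ , v ∷ ys , e ◅ w′ , Te′ ,
       (λ { (here refl) → here refl ; (there y∈) → there (ys⊆ y∈) }) ,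
       λ { (here refl) Tv → ⊥-elim (¬Tv Tv) ; (there y∈) → first y∈ }

  WalkIn : (V → Set) → V → V → Set
  WalkIn P a b = ∃ λ xs → Walk a b xs × All P xs

  _◅◅ᴾ_ : ∀ {P a b c} → WalkIn P a b → WalkIn P b c → WalkIn P a c
  (xs , p , Pxs) ◅◅ᴾ (ys , q , Pys) = xs ++ ys , p ◅◅ q , All-++⁺ Pxs Pys

  module _ {P : V → Set} where

    walk-from-zero : ∀ {m} (f : Fin (suc m) → V) → (∀ i → P (f i)) →
                     (∀ i → Arc (f (inject₁ i)) (f (fsuc i))) → ∀ j → WalkIn P (f fzero) (f j)
    walk-from-zero f Pf step fzero = [] , ε , []
    walk-from-zero {suc _} f Pf step (fsuc j) =
      walk-from-zero (f ∘ inject₁) (Pf ∘ inject₁) (step ∘ inject₁) j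
        ◅◅ᴾ ([ f (fsuc j) ] , step j ◅ ε , Pf (fsuc j) ∷ [])

    walk-to-last : ∀ {m} (f : Fin (suc m) → V) → (∀ i → P (f i)) →
                   (∀ i → Arc (f (inject₁ i)) (f (fsuc i))) → ∀ i → WalkIn P (f i) (f (fromℕ m))
    walk-to-last {zero} f Pf step fzero = [] , ε , []
    walk-to-last {suc _} f Pf step fzero =
      ([ f (fsuc fzero) ] , step fzero ◅ ε , Pf (fsuc fzero) ∷ [])
        ◅◅ᴾ walk-to-last (f ∘ fsuc) (Pf ∘ fsuc) (step ∘ fsuc) fzero
    walk-to-last {suc _} f Pf step (fsuc i) = walk-to-last (f ∘ fsuc) (Pf ∘ fsuc) (step ∘ fsuc) i

    cyclic-walk : ∀ {k} (f : Fin k → V) → (∀ i → P (f i)) →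
                  (∀ i j → CycSucc k i j → Arc (f i) (f j)) → ∀ i j → WalkIn P (f i) (f j)
    cyclic-walk {suc m} f Pf succ-arc i j =
      walk-to-last f Pf step i ◅◅ᴾ (([ f fzero ] , wrap ◅ ε , Pf fzero ∷ []) ◅◅ᴾ walk-from-zero f Pf step j)
      where
      step : ∀ i → Arc (f (inject₁ i)) (f (fsuc i))
      step i = succ-arc _ _ (inj₁ (cong suc (toℕ-inject₁ i)))
      wrap : Arc (f (fromℕ m)) (f fzero)
      wrap = succ-arc _ _ (inj₂ (cong suc (toℕ-fromℕ m) , refl))

  infix 4 _∈ᶜ_

  record _∈ᶜ_ (v : V) (C : DiCycle D) : Set where
    constructor at
    field
      index  : Fin (len C)
      vtx≡   : vtx C index ≡ v

  _∈ᶜ?_ : ∀ v C → Dec (v ∈ᶜ C)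
  v ∈ᶜ? C = Dec.map′ (λ (i , eq) → at i eq) (λ (at i eq) → i , eq) (any? λ i → vtx C i ≟ᶠ v)

  common⇒shares : ∀ {v C C′} → v ∈ᶜ C → v ∈ᶜ C′ → Shares C C′
  common⇒shares (at i refl) (at j eq) = i , j , sym eq

  shares⇒common : ∀ {C C′} → Shares C C′ → ∃ λ v → v ∈ᶜ C × v ∈ᶜ C′
  shares⇒common {C} (i , j , eq) = vtx C i , at i refl , at j (sym eq)

  record Segment (C : DiCycle D) (T : V → Set) (u : V) : Set where
    field
      end    : V
      vs     : List V
      walk   : Walk u end vs
      unique : Unique (u ∷ vs)
      on-C   : All (_∈ᶜ C) vs
      hit    : T end
      first  : ∀ {y} → y ∈ vs → T y → y ≡ end

  segment : ∀ C {T : V → Set} → Decidable T → ∀ {u b} → u ∈ᶜ C → b ∈ᶜ C → T b → Segment C T u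
  segment C T? (at i refl) (at j refl) Tb =
    let xs , w , xs∈C = cyclic-walk (vtx C) (λ p → at p refl) (arcs C) i j
        e , ys , w′ , Te , ys⊆xs , first = prefix-to-first T? w Tb
        zs , w″ , zs! , zs⊆ys = walk⇒path w′
    in record { end = e ; vs = zs ; walk = w″ ; unique = zs!
              ; on-C = anti-mono (ys⊆xs ∘ zs⊆ys) xs∈C ; hit = Te ; first = first ∘ zs⊆ys }

  lookup-injective : ∀ {xs : List V} → Unique xs → ∀ i j → lookup xs i ≡ lookup xs j → i ≡ j
  lookup-injective (_ ∷ _) fzero fzero _ = refl
  lookup-injective (x∉ ∷ _) fzero (fsuc j) eq = ⊥-elim (All.lookup x∉ (∈-lookup j) eq)
  lookup-injective (x∉ ∷ _) (fsuc i) fzero eq = ⊥-elim (All.lookup x∉ (∈-lookup i) (sym eq))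
  lookup-injective (_ ∷ xs!) (fsuc i) (fsuc j) eq = cong fsuc (lookup-injective xs! i j eq)

  walk-arc : ∀ {a b xs} → Walk a b xs → ∀ i j → suc (toℕ i) ≡ toℕ j → Arc (lookup xs i) (lookup xs j)
  walk-arc (_ ◅ e ◅ _) fzero (fsuc fzero) _ = e
  walk-arc (_ ◅ w) (fsuc i) (fsuc j) eq = walk-arc w i j (suc-injective eq)

  walk-last : ∀ {a b xs} → Walk a b xs → ∀ i → suc (toℕ i) ≡ length xs → lookup xs i ≡ b
  walk-last (_ ◅ ε) fzero _ = refl
  walk-last (_ ◅ w) (fsuc i) eq = walk-last w i (suc-injective eq)

  closing-arc : ∀ {u zs} → Walk u u zs → ∀ i j → suc (toℕ i) ≡ length zs → toℕ j ≡ 0 →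
                Arc (lookup zs i) (lookup zs j)
  closing-arc w@(e ◅ _) i fzero i+1≡len _ = subst (λ x → Arc x _) (sym (walk-last w i i+1≡len)) e

  closed-path⇒cycle : ∀ {u zs} → Walk u u zs → Unique zs → 2 ≤ length zs → DiCycle D
  closed-path⇒cycle {zs = zs} w zs! 2≤|zs| = record
    { len = length zs ; len≥2 = 2≤|zs| ; vtx = lookup zs ; inj = lookup-injective zs! ; arcs = arcs′ }
    where
    arcs′ : ∀ i j → CycSucc (length zs) i j → Arc (lookup zs i) (lookup zs j)
    arcs′ i j (inj₁ i+1≡j) = walk-arc w i j i+1≡j
    arcs′ i j (inj₂ (i+1≡len , j≡0)) = closing-arc w i j i+1≡len j≡0

  module Chain (U : ℕ → DiCycle D) (K : ℕ)
               (meets : ∀ {i} → i < K → Shares (U i) (U (suc i)))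
               (apart : ∀ {i j} → 2 + i ≤ j → j ≤ K → ¬ Shares (U i) (U j))
               {s : V} (s∈U₀ : s ∈ᶜ U 0) (s∉U₁ : ¬ s ∈ᶜ U 1) where

    record ChainPath (k : ℕ) : Set where
      field
        end    : V
        vs     : List V
        walk   : Walk s end vs
        unique : Unique (s ∷ vs)
        visits : All (λ x → ∃ λ j → j < k × x ∈ᶜ U j) vs
        end∈U  : end ∈ᶜ U k
        first  : ∀ {x} → x ∈ s ∷ vs → x ∈ᶜ U k → x ≡ end
        long   : k ≤ length vs

    avoids-next : ∀ {k} → suc k ≤ K → (P : ChainPath k) →
                  ∀ {x} → x ∈ s ∷ ChainPath.vs P → ¬ x ∈ᶜ U (suc k)
    avoids-next {zero} _ _ (here refl) = s∉U₁
    avoids-next {suc k} k+1≤K _ (here refl) s∈U = apart (s≤s (s≤s z≤n)) k+1≤K (common⇒shares s∈U₀ s∈U)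
    avoids-next k+1≤K P (there x∈) with All.lookup (ChainPath.visits P) x∈
    ... | j , j<k , x∈Uj = λ x∈U → apart (s≤s j<k) k+1≤K (common⇒shares x∈Uj x∈U)

    extend : ∀ {k} → suc k ≤ K → ChainPath k → ChainPath (suc k)
    extend {k} k+1≤K P = record
      { end = end S ; vs = vs P ++ vs S ; walk = walk P ◅◅ walk S
      ; unique = Unique-++⁺ {xs = s ∷ vs P} (unique P) (tail-unique (unique S)) disjoint
      ; visits = All-++⁺ (All.map (λ (j , j<k , x∈) → j , m≤n⇒m≤1+n j<k , x∈) (visits P))
                         (All.map (λ x∈ → k , ≤-refl , x∈) (on-C S))
      ; end∈U = hit S
      ; first = first′
      ; long = longer
      }
      where
      open ChainPath
      open Segment
      S : Segment (U k) (_∈ᶜ U (suc k)) (end P)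
      S = let _ , b∈U , b∈U′ = shares⇒common (meets k+1≤K)
          in segment (U k) (_∈ᶜ? U (suc k)) (end∈U P) b∈U b∈U′
      disjoint : Disjoint (s ∷ vs P) (vs S)
      disjoint (x∈P , x∈S) = head∉tail (unique S) x∈S (sym (first P x∈P (All.lookup (on-C S) x∈S)))
      first′ : ∀ {x} → x ∈ (s ∷ vs P) ++ vs S → x ∈ᶜ U (suc k) → x ≡ end S
      first′ x∈ x∈U with ∈-++⁻ (s ∷ vs P) x∈
      ... | inj₁ x∈P = ⊥-elim (avoids-next k+1≤K P x∈P x∈U)
      ... | inj₂ x∈S = Segment.first S x∈S x∈U
      end≢end : end P ≢ end S
      end≢end eq = avoids-next k+1≤K P (end∈ (walk P)) (subst (_∈ᶜ U (suc k)) (sym eq) (hit S))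
      longer : suc k ≤ length (vs P ++ vs S)
      longer = begin
        suc k                          ≡⟨ +-comm 1 k ⟩
        k + 1                          ≤⟨ +-mono-≤ (long P) (length-pos (walk S) end≢end) ⟩
        length (vs P) + length (vs S)  ≡⟨ sym (length-++ (vs P)) ⟩
        length (vs P ++ vs S)          ∎
        where open ≤-Reasoning

    chain-path : ∀ k → k ≤ K → ChainPath k
    chain-path zero _ = record
      { end = s ; vs = [] ; walk = ε ; unique = [] ∷ [] ; visits = [] ; end∈U = s∈U₀
      ; first = λ { (here refl) _ → refl } ; long = z≤n }
    chain-path (suc k) k+1≤K = extend k+1≤K (chain-path k (≤-trans (n≤1+n k) k+1≤K))

  module _ {ℓ} (IC : InducedCycleInCycleGraph D ℓ) where
    open InducedCycleInCycleGraph IC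

    cycSucc⇒shares : 2 ≤ ℓ → ∀ {a b} → CycSucc ℓ a b → Shares (cyc a) (cyc b)
    cycSucc⇒shares 2≤ℓ a→b = proj₂ (induced _ _ (cycSucc⇒≢ 2≤ℓ a→b)) (inj₁ a→b)

    far⇒¬shares : ∀ {a b i j} → toℕ a ≡ i → toℕ b ≡ j → 2 + i ≤ j → (1 ≤ i ⊎ suc j < ℓ) →
                  ¬ Shares (cyc a) (cyc b)
    far⇒¬shares refl refl i+2≤j side =
      far⇒¬cycAdj i+2≤j side ∘ proj₁ (induced _ _ (<⇒≢ᶠ (≤-trans (n≤1+n _) i+2≤j)))

  module LongCycle (K : ℕ) (2≤K : 2 ≤ K) (IC : InducedCycleInCycleGraph D (2 + K)) where
    open InducedCycleInCycleGraph IC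

    ℓ : ℕ
    ℓ = 2 + K

    -- mod only makes W total; it is used at indices below ℓ.
    W : ℕ → DiCycle D
    W i = cyc (i mod ℓ)

    B : DiCycle D
    B = W (suc K)

    W-succ : ∀ {i} → suc i < ℓ → Shares (W i) (W (suc i))
    W-succ {i} i+1<ℓ = cycSucc⇒shares IC (s≤s (s≤s z≤n))
      (inj₁ (trans (cong suc (m<n⇒toℕ-mod≡m (<-trans (n<1+n i) i+1<ℓ)))
                   (sym (m<n⇒toℕ-mod≡m i+1<ℓ))))

    W-wrap : Shares B (W 0)
    W-wrap = cycSucc⇒shares IC (s≤s (s≤s z≤n)) (inj₂ (cong suc (m<n⇒toℕ-mod≡m ≤-refl) , refl))

    W-far : ∀ {i j} → 2 + i ≤ j → j < ℓ → (1 ≤ i ⊎ suc j < ℓ) → ¬ Shares (W i) (W j)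
    W-far i+2≤j j<ℓ = far⇒¬shares IC (m<n⇒toℕ-mod≡m (<-trans (≤-trans (n≤1+n _) i+2≤j) j<ℓ))
                                     (m<n⇒toℕ-mod≡m j<ℓ) i+2≤j

    W-apart : ∀ {i j} → 2 + i ≤ j → j ≤ K → ¬ Shares (W i) (W j)
    W-apart i+2≤j j≤K = W-far i+2≤j (s≤s (m≤n⇒m≤1+n j≤K)) (inj₂ (s≤s (s≤s j≤K)))

    B∩W⇒W₀ : ∀ {x j} → x ∈ᶜ B → x ∈ᶜ W j → j < K → x ∈ᶜ W 0
    B∩W⇒W₀ {j = zero} _ x∈W₀ _ = x∈W₀
    B∩W⇒W₀ {j = suc j} x∈B x∈W j<K =
      ⊥-elim (W-far (s≤s j<K) ≤-refl (inj₁ (s≤s z≤n)) (common⇒shares x∈W x∈B))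

    module Closing {s₀ b} (s₀∈W : s₀ ∈ᶜ W K) (s₀∈B : s₀ ∈ᶜ B) (b∈B : b ∈ᶜ B) (b∈W₀ : b ∈ᶜ W 0) where
      open Segment

      S : Segment B (_∈ᶜ W 0) s₀
      S = segment B (_∈ᶜ? W 0) s₀∈B b∈B b∈W₀

      on-B : ∀ {x} → x ∈ s₀ ∷ vs S → x ∈ᶜ B
      on-B = All.lookup (s₀∈B ∷ on-C S)

      end∉W₁ : ¬ end S ∈ᶜ W 1
      end∉W₁ x∈W₁ =
        W-far (s≤s 2≤K) ≤-refl (inj₁ (s≤s z≤n)) (common⇒shares x∈W₁ (on-B (end∈ (walk S))))

      open Chain W K (λ i<K → W-succ (s≤s (m≤n⇒m≤1+n i<K))) W-apart (hit S) end∉W₁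

      P : ChainPath K
      P = chain-path K ≤-refl

      module P = ChainPath P

      chain∩B⇒W₀ : ∀ {x} → x ∈ end S ∷ P.vs → x ∈ᶜ B → x ∈ᶜ W 0
      chain∩B⇒W₀ (here refl) _ = hit S
      chain∩B⇒W₀ (there x∈) x∈B = let _ , j<K , x∈W = All.lookup P.visits x∈ in B∩W⇒W₀ x∈B x∈W j<K

      R : Segment (W K) (_∈ s₀ ∷ vs S) P.end
      R = segment (W K) (λ x → anyᴸ? (x ≟ᶠ_) (s₀ ∷ vs S)) P.end∈U s₀∈W (here refl)

      long-cycle : Σ (DiCycle D) λ C → ℓ ≤ len C
      long-cycle with path-suffix (walk S) (unique S) (hit R)
      ... | q , walk-q , q! , q⊆S =
        closed-path⇒cycle closed repetition-free (≤-trans (s≤s (s≤s z≤n)) long) , long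
        where
        closed : Walk (end R) (end R) (q ++ P.vs ++ vs R)
        closed = walk-q ◅◅ P.walk ◅◅ walk R

        P#R : Disjoint P.vs (vs R)
        P#R (x∈P , x∈R) = head∉tail (unique R) x∈R (sym (P.first (there x∈P) (All.lookup (on-C R) x∈R)))

        q#P++R : Disjoint q (P.vs ++ vs R)
        q#P++R (x∈q , x∈P++R) with ∈-++⁻ P.vs x∈P++R
        ... | inj₁ x∈P = head∉tail P.unique x∈P
                           (sym (first S (q⊆S x∈q) (chain∩B⇒W₀ (there x∈P) (on-B (there (q⊆S x∈q))))))
        ... | inj₂ x∈R = head∉tail q! x∈q (sym (first R x∈R (there (q⊆S x∈q))))

        repetition-free : Unique (q ++ P.vs ++ vs R)
        repetition-free = Unique-++⁺ (tail-unique q!)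
          (Unique-++⁺ (tail-unique P.unique) (tail-unique (unique R)) P#R) q#P++R

        end-R∈W : end R ∈ᶜ W K
        end-R∈W = All.lookup (P.end∈U ∷ on-C R) (end∈ (walk R))

        end-R≢end-S : end R ≢ end S
        end-R≢end-S eq = W-apart 2≤K ≤-refl (common⇒shares (hit S) (subst (_∈ᶜ W K) eq end-R∈W))

        end-P≢end-R : P.end ≢ end R
        end-P≢end-R eq = W-apart 2≤K ≤-refl
          (common⇒shares (chain∩B⇒W₀ (end∈ P.walk) (subst (_∈ᶜ B) (sym eq) (on-B (hit R)))) P.end∈U)

        long : ℓ ≤ length (q ++ P.vs ++ vs R)
        long = begin
          2 + K                                     ≡⟨ cong suc (+-comm 1 K) ⟩
          1 + (K + 1)                               ≤⟨ +-mono-≤ (length-pos walk-q end-R≢end-S)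
                                                         (+-mono-≤ P.long (length-pos (walk R) end-P≢end-R)) ⟩
          length q + (length P.vs + length (vs R))  ≡⟨ cong (length q +_) (length-++ P.vs) ⟨
          length q + length (P.vs ++ vs R)          ≡⟨ length-++ q ⟨
          length (q ++ P.vs ++ vs R)                ∎
          where open ≤-Reasoning

    long-cycle : Σ (DiCycle D) λ C → ℓ ≤ len C
    long-cycle with shares⇒common (W-succ {K} ≤-refl) | shares⇒common W-wrap
    ... | _ , s₀∈W , s₀∈B | _ , b∈B , b∈W₀ = Closing.long-cycle s₀∈W s₀∈B b∈B b∈W₀

lemma2p8 : (D : Digraph) (ℓ : ℕ) → 4 ≤ ℓ → InducedCycleInCycleGraph D ℓ →
    Σ (DiCycle D) (λ C → ℓ ≤ DiCycle.len C)
lemma2p8 D (suc (suc K)) (s≤s (s≤s 2≤K)) IC = LongCycle.long-cycle D K 2≤K IC
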